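{- Let $H$ be a Hadamard matrix of order $v$ and let $X\in\{\pm1\}^v$ be a bent sequence for $H$. Then there is a Hadamard matrix $H'$ equivalent to $H$ such that $X$ is a self-dual bent sequence for $H'$.
   Context: A Hadamard matrix of order $v$ is a $v\times v$ matrix with entries $\pm1$ satisfying $HH^t=vI_v$. Two Hadamard matrices are equivalent if one is obtained from the other by row permutations, column permutations, and negations of rows or columns, i.e. $H'=PHQ$ with $P,Q$ signed permutation matrices. $X\in\{\pm1\}^v$ is a bent sequence for $H$ if $\frac{1}{\sqrt v}HX\in\{\pm1\}^v$, and a self-dual bent sequence for $H$ if $\frac{1}{\sqrt v}HX=X$. -}

module Defs where

open import Data.Nat using (ℕ)
open import Data.Integer using (ℤ; +_; _*_; _+_; -_; 0ℤ; 1ℤ)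
open import Data.Fin using (Fin; zero; suc)
open import Data.Fin.Properties using () renaming (_≟_ to _≟ᶠ_)
open import Data.Product using (Σ; _×_; ∃; ∃-syntax)
open import Data.Sum using (_⊎_)
open import Relation.Binary.PropositionalEquality using (_≡_)
open import Relation.Nullary using (yes; no)
open import Function.Bundles using (_↔_; Inverse)

Matrix : ℕ → Set
Matrix v = Fin v → Fin v → ℤ

Vector : ℕ → Set
Vector v = Fin v → ℤ

sumFin : (n : ℕ) → (Fin n → ℤ) → ℤ
sumFin ℕ.zero f = 0ℤ
sumFin (ℕ.suc n) f = f zero + sumFin n (λ k → f (suc k))

IsSign : ℤ → Set
IsSign x = (x ≡ 1ℤ) ⊎ (x ≡ - 1ℤ)

IsPMOne : {v : ℕ} → Vector v → Set
IsPMOne {v} X = ∀ i → IsSign (X i)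

δ : {v : ℕ} → Fin v → Fin v → ℤ
δ i j with i ≟ᶠ j
... | yes _ = 1ℤ
... | no _ = 0ℤ

IsHadamard : (v : ℕ) → Matrix v → Set
IsHadamard v H =
  (∀ i j → IsSign (H i j)) ×
  (∀ i j → sumFin v (λ k → H i k * H j k) ≡ + v * δ i j)

mulVec : {v : ℕ} → Matrix v → Vector v → Vector v
mulVec {v} H X i = sumFin v (λ k → H i k * X k)

-- H' = P H Q with P, Q signed permutation matrices:
-- H' i j = ε i * H (σ i) (τ j) * η j
Equivalent : (v : ℕ) → Matrix v → Matrix v → Set
Equivalent v H H' =
  Σ (Fin v ↔ Fin v) λ σ → Σ (Fin v ↔ Fin v) λ τ →
  Σ (Vector v) λ ε → Σ (Vector v) λ η →
  IsPMOne ε × IsPMOne η ×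
  (∀ i j → H' i j ≡ ε i * H (Inverse.to σ i) (Inverse.to τ j) * η j)

-- (1/√v) H X ∈ {±1}^v ; √v is expressed as a natural s with s*s = v
-- (if v is not a perfect square no ±1 vector can be bent, since H X is integral)
IsBent : (v : ℕ) → Matrix v → Vector v → Set
IsBent v H X =
  IsPMOne X ×
  Σ ℕ λ s → (s Data.Nat.* s ≡ v) × Σ (Vector v) λ Y →
    IsPMOne Y × (∀ i → mulVec H X i ≡ + s * Y i)

IsSelfDualBent : (v : ℕ) → Matrix v → Vector v → Set
IsSelfDualBent v H X =
  IsPMOne X ×
  Σ ℕ λ s → (s Data.Nat.* s ≡ v) × (∀ i → mulVec H X i ≡ + s * X i)

-- Negating row i of H multiplies the i-th entry of H X by ε i. Since X and
-- Y = (1/√v) H X are ±1 vectors, negating exactly the rows where Y and X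
-- differ (ε i = Y i X i) turns H X into √v X; row negation keeps H Hadamard
-- because ε i ε j δ i j = δ i j.
module Submission where

open import Defs
open import Data.Nat using (ℕ)
open import Data.Product using (Σ; _×_; _,_)
open import Data.Integer using (ℤ; +_; _*_; _+_; 0ℤ; 1ℤ)
open import Data.Integer.Properties using (*-zeroʳ; *-identityˡ; *-distribˡ-+)
open import Data.Integer.Tactic.RingSolver using (solve-∀)
open import Data.Sum using (inj₁; inj₂)
open import Data.Fin using (Fin; zero; suc)
open import Data.Fin.Properties using () renaming (_≟_ to _≟ᶠ_)
open import Relation.Nullary using (yes; no)
open import Relation.Binary.PropositionalEquality
open import Function.Construct.Identity using (↔-id)

sumFin-cong : ∀ n {f g : Fin n → ℤ} → (∀ k → f k ≡ g k) → sumFin n f ≡ sumFin n g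
sumFin-cong ℕ.zero    f≗g = refl
sumFin-cong (ℕ.suc n) f≗g = cong₂ _+_ (f≗g zero) (sumFin-cong n (λ k → f≗g (suc k)))

sumFin-*ˡ : ∀ n c (f : Fin n → ℤ) → sumFin n (λ k → c * f k) ≡ c * sumFin n f
sumFin-*ˡ ℕ.zero    c f = sym (*-zeroʳ c)
sumFin-*ˡ (ℕ.suc n) c f = begin
  c * f zero + sumFin n (λ k → c * f (suc k)) ≡⟨ cong (_+_ (c * f zero)) (sumFin-*ˡ n c _) ⟩
  c * f zero + c * sumFin n (λ k → f (suc k)) ≡⟨ sym (*-distribˡ-+ c _ _) ⟩
  c * (f zero + sumFin n (λ k → f (suc k)))   ∎
  where open ≡-Reasoning

sign*sign≡1 : ∀ {a} → IsSign a → a * a ≡ 1ℤ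
sign*sign≡1 (inj₁ refl) = refl
sign*sign≡1 (inj₂ refl) = refl

sign-* : ∀ {a b} → IsSign a → IsSign b → IsSign (a * b)
sign-* (inj₁ refl) (inj₁ refl) = inj₁ refl
sign-* (inj₁ refl) (inj₂ refl) = inj₂ refl
sign-* (inj₂ refl) (inj₁ refl) = inj₂ refl
sign-* (inj₂ refl) (inj₂ refl) = inj₁ refl

pmOne-* : ∀ {v} {X Y : Vector v} → IsPMOne X → IsPMOne Y → IsPMOne (λ i → X i * Y i)
pmOne-* pX pY i = sign-* (pX i) (pY i)

signs-*-δ : ∀ {v} {ε : Vector v} → IsPMOne ε → ∀ m i j → ε i * ε j * (m * δ i j) ≡ m * δ i j
signs-*-δ {ε = ε} pε m i j with i ≟ᶠ j
... | yes refl = begin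
  ε i * ε i * (m * 1ℤ) ≡⟨ cong (_* (m * 1ℤ)) (sign*sign≡1 (pε i)) ⟩
  1ℤ * (m * 1ℤ)        ≡⟨ *-identityˡ _ ⟩
  m * 1ℤ               ∎
  where open ≡-Reasoning
... | no _ = begin
  ε i * ε j * (m * 0ℤ) ≡⟨ cong (ε i * ε j *_) (*-zeroʳ m) ⟩
  ε i * ε j * 0ℤ       ≡⟨ *-zeroʳ (ε i * ε j) ⟩
  0ℤ                   ≡⟨ sym (*-zeroʳ m) ⟩
  m * 0ℤ               ∎
  where open ≡-Reasoning

-- The trailing factor 1ℤ is the (trivial) column sign, so that the matrix has
-- literally the shape demanded by Equivalent.
negateRows : ∀ {v} → Vector v → Matrix v → Matrix v
negateRows ε H i j = ε i * H i j * 1ℤ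

negateRows-equivalent : ∀ v (H : Matrix v) {ε : Vector v} → IsPMOne ε →
                        Equivalent v H (negateRows ε H)
negateRows-equivalent v H {ε} pε =
  ↔-id _ , ↔-id _ , ε , (λ _ → 1ℤ) , pε , (λ _ → inj₁ refl) , (λ i j → refl)

negateRows-hadamard : ∀ v {H : Matrix v} {ε : Vector v} → IsPMOne ε →
                      IsHadamard v H → IsHadamard v (negateRows ε H)
negateRows-hadamard v {H} {ε} pε (signs , orthogonal) = signs′ , orthogonal′
  where
  signs′ : ∀ i j → IsSign (negateRows ε H i j)
  signs′ i j = sign-* (sign-* (pε i) (signs i j)) (inj₁ refl)

  regroup : ∀ a b c d → (a * b * 1ℤ) * (c * d * 1ℤ) ≡ (a * c) * (b * d)
  regroup = solve-∀

  orthogonal′ : ∀ i j → sumFin v (λ k → negateRows ε H i k * negateRows ε H j k) ≡ + v * δ i j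
  orthogonal′ i j = begin
    sumFin v (λ k → negateRows ε H i k * negateRows ε H j k)
      ≡⟨ sumFin-cong v (λ k → regroup (ε i) (H i k) (ε j) (H j k)) ⟩
    sumFin v (λ k → ε i * ε j * (H i k * H j k))
      ≡⟨ sumFin-*ˡ v (ε i * ε j) _ ⟩
    ε i * ε j * sumFin v (λ k → H i k * H j k)
      ≡⟨ cong (ε i * ε j *_) (orthogonal i j) ⟩
    ε i * ε j * (+ v * δ i j)
      ≡⟨ signs-*-δ pε (+ v) i j ⟩
    + v * δ i j ∎
    where open ≡-Reasoning

mulVec-negateRows : ∀ v (ε : Vector v) (H : Matrix v) (X : Vector v) i →
                    mulVec (negateRows ε H) X i ≡ ε i * mulVec H X i
mulVec-negateRows v ε H X i = begin
  sumFin v (λ k → ε i * H i k * 1ℤ * X k) ≡⟨ sumFin-cong v (λ k → regroup (ε i) (H i k) (X k)) ⟩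
  sumFin v (λ k → ε i * (H i k * X k))    ≡⟨ sumFin-*ˡ v (ε i) _ ⟩
  ε i * mulVec H X i                      ∎
  where
  open ≡-Reasoning
  regroup : ∀ a b c → a * b * 1ℤ * c ≡ a * (b * c)
  regroup = solve-∀

bent-flip : ∀ s {x y} → IsSign y → y * x * (+ s * y) ≡ + s * x
bent-flip s {x} {y} py = begin
  y * x * (+ s * y)   ≡⟨ regroup y x (+ s) ⟩
  y * y * (+ s * x)   ≡⟨ cong (_* (+ s * x)) (sign*sign≡1 py) ⟩
  1ℤ * (+ s * x)      ≡⟨ *-identityˡ _ ⟩
  + s * x             ∎
  where
  open ≡-Reasoning
  regroup : ∀ y x t → y * x * (t * y) ≡ y * y * (t * x)
  regroup = solve-∀

mainTheorem5 : (v : ℕ) (H : Matrix v) (X : Vector v) →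
    IsHadamard v H → IsBent v H X →
    Σ (Matrix v) λ H' → IsHadamard v H' × Equivalent v H H' × IsSelfDualBent v H' X
mainTheorem5 v H X hadamard (pX , s , s*s≡v , Y , pY , HX≡sY) =
  negateRows ε H ,
  negateRows-hadamard v pε hadamard ,
  negateRows-equivalent v H pε ,
  (pX , s , s*s≡v , selfDual)
  where
  ε : Vector v
  ε i = Y i * X i

  pε : IsPMOne ε
  pε = pmOne-* pY pX

  selfDual : ∀ i → mulVec (negateRows ε H) X i ≡ + s * X i
  selfDual i = begin
    mulVec (negateRows ε H) X i ≡⟨ mulVec-negateRows v ε H X i ⟩
    ε i * mulVec H X i          ≡⟨ cong (ε i *_) (HX≡sY i) ⟩
    ε i * (+ s * Y i)           ≡⟨ bent-flip s (pY i) ⟩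
    + s * X i                   ∎
    where open ≡-Reasoning
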